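{- Every $\mathsf{iA}$-logic $\Lambda$ is characterised by a class $\mathcal{C}$ of descriptive $\rightsquigarrow$-frames, i.e. for every formula $\varphi$, $\varphi\in\Lambda$ iff $\mathfrak{G}\Vdash\varphi$ for all $\mathfrak{G}\in\mathcal{C}$.
   Context: Formulas: $\varphi::=p\mid\top\mid\bot\mid\varphi\wedge\varphi\mid\varphi\vee\varphi\mid\varphi\to\varphi\mid\varphi\rightsquigarrow\varphi$ ($p$ ranging over propositional variables); $\neg\varphi:=\varphi\to\bot$, $\Box\varphi:=\top\rightsquigarrow\varphi$. An $\mathsf{iA}$-logic is a set of formulas containing all theorems of intuitionistic propositional logic and all instances of $((\varphi\rightsquigarrow\psi)\wedge(\varphi\rightsquigarrow\chi))\to(\varphi\rightsquigarrow(\psi\wedge\chi))$, $((\varphi\rightsquigarrow\chi)\wedge(\psi\rightsquigarrow\chi))\to((\varphi\vee\psi)\rightsquigarrow\chi)$, $((\varphi\rightsquigarrow\psi)\wedge(\psi\rightsquigarrow\chi))\to(\varphi\rightsquigarrow\chi)$, closed under modus ponens, under the rule from $\varphi\to\psi$ infer $\varphi\rightsquigarrow\psi$, and under uniform substitution. A $\rightsquigarrow$-frame is $(X,\preceq,\sqsubset)$ with $\preceq$ a partial order and $\sqsubset$ a relation with $x\preceq y\sqsubset z\Rightarrow x\sqsubset z$. For upsets $a,b$: $a\underline{\to}b=\{x:\forall y(x\preceq y, y\in a\Rightarrow y\in b)\}$, $a\underline{\rightsquigarrow}b=\{x:\forall y(x\sqsubset y,y\in a\Rightarrow y\in b)\}$.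 A general $\rightsquigarrow$-frame $(X,\preceq,\sqsubset,P)$ has $P$ a family of upsets containing $X,\emptyset$ closed under $\cap,\cup,\underline{\to},\underline{\rightsquigarrow}$; it is descriptive if compact (for $A\subseteq P$, $B\subseteq\{X\setminus a:a\in P\}$, if $A\cup B$ has the finite intersection property then $\bigcap(A\cup B)\ne\emptyset$), $\preceq$-refined ($x\not\preceq y$ implies some $a\in P$ with $x\in a,y\notin a$) and $\sqsubset$-refined ($x\not\sqsubset y$ implies some $a,b\in P$ with $x\in a\underline{\rightsquigarrow}b$, $y\in a$, $y\notin b$). A valuation into $P$ assigns each variable an element of $P$; truth sets are defined with $\top\mapsto X$, $\bot\mapsto\emptyset$, $\wedge,\vee\mapsto\cap,\cup$, $\to\mapsto\underline{\to}$, $\rightsquigarrow\mapsto\underline{\rightsquigarrow}$; $\mathfrak G\Vdash\varphi$ means the truth set of $\varphi$ is $X$ under every valuation into $P$. -}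

module Defs where

open import Level using (Level; _⊔_; Lift; lift) renaming (suc to lsuc; zero to lzero)
open import Data.Nat using (ℕ)
open import Data.Unit using (⊤)
open import Data.Empty using (⊥)
open import Data.Product using (Σ; _×_; _,_; proj₁; ∃; ∃-syntax)
open import Data.Sum using (_⊎_)
open import Data.List using (List)
open import Data.List.Relation.Unary.All using (All)
open import Relation.Nullary using (¬_)
open import Relation.Binary using (Rel; IsPartialOrder)
open import Relation.Unary using (Pred)

infixr 6 _∧'_
infixr 5 _∨'_
infixr 4 _⇒_ _⇝_

data Formula : Set where
  var  : ℕ → Formula
  ⊤'   : Formula
  ⊥'   : Formula
  _∧'_ : Formula → Formula → Formula
  _∨'_ : Formula → Formula → Formula
  _⇒_  : Formula → Formula → Formula
  _⇝_  : Formula → Formula → Formula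

¬' : Formula → Formula
¬' φ = φ ⇒ ⊥'

□ : Formula → Formula
□ φ = ⊤' ⇝ φ

Subst : Set
Subst = ℕ → Formula

sub : Subst → Formula → Formula
sub σ (var p)  = σ p
sub σ ⊤'       = ⊤'
sub σ ⊥'       = ⊥'
sub σ (φ ∧' ψ) = sub σ φ ∧' sub σ ψ
sub σ (φ ∨' ψ) = sub σ φ ∨' sub σ ψ
sub σ (φ ⇒ ψ)  = sub σ φ ⇒ sub σ ψ
sub σ (φ ⇝ ψ)  = sub σ φ ⇝ sub σ ψ

-- Theorems of intuitionistic propositional logic in this language:
-- a standard Hilbert system for IPC whose axiom schemata range over
-- all formulas of the language (so ⇝-formulas are treated as atoms),
-- closed under modus ponens.

data IPC : Formula → Set where
  K    : ∀ φ ψ → IPC (φ ⇒ (ψ ⇒ φ))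
  S    : ∀ φ ψ χ → IPC ((φ ⇒ (ψ ⇒ χ)) ⇒ ((φ ⇒ ψ) ⇒ (φ ⇒ χ)))
  ∧E₁  : ∀ φ ψ → IPC ((φ ∧' ψ) ⇒ φ)
  ∧E₂  : ∀ φ ψ → IPC ((φ ∧' ψ) ⇒ ψ)
  ∧I   : ∀ φ ψ → IPC (φ ⇒ (ψ ⇒ (φ ∧' ψ)))
  ∨I₁  : ∀ φ ψ → IPC (φ ⇒ (φ ∨' ψ))
  ∨I₂  : ∀ φ ψ → IPC (ψ ⇒ (φ ∨' ψ))
  ∨E   : ∀ φ ψ χ → IPC ((φ ⇒ χ) ⇒ ((ψ ⇒ χ) ⇒ ((φ ∨' ψ) ⇒ χ)))
  ⊥E   : ∀ φ → IPC (⊥' ⇒ φ)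
  ⊤I   : IPC ⊤'
  mp   : ∀ {φ ψ} → IPC (φ ⇒ ψ) → IPC φ → IPC ψ

record IsIALogic (Λ : Formula → Set) : Set where
  field
    ipc    : ∀ {φ} → IPC φ → Λ φ
    ax-∧   : ∀ φ ψ χ → Λ (((φ ⇝ ψ) ∧' (φ ⇝ χ)) ⇒ (φ ⇝ (ψ ∧' χ)))
    ax-∨   : ∀ φ ψ χ → Λ (((φ ⇝ χ) ∧' (ψ ⇝ χ)) ⇒ ((φ ∨' ψ) ⇝ χ))
    ax-tr  : ∀ φ ψ χ → Λ (((φ ⇝ ψ) ∧' (ψ ⇝ χ)) ⇒ (φ ⇝ χ))
    closed-mp : ∀ {φ ψ} → Λ (φ ⇒ ψ) → Λ φ → Λ ψ
    ⇝-rule    : ∀ {φ ψ} → Λ (φ ⇒ ψ) → Λ (φ ⇝ ψ)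
    subst  : ∀ {φ} (σ : Subst) → Λ φ → Λ (sub σ φ)

module _ {c : Level} {X : Set c} where

  IsUpset : Rel X c → Pred X c → Set c
  IsUpset _⪯_ a = ∀ {x y} → x ⪯ y → a x → a y

  full : Pred X c
  full _ = Lift c ⊤

  empty : Pred X c
  empty _ = Lift c ⊥

  _∩_ : Pred X c → Pred X c → Pred X c
  (a ∩ b) x = a x × b x

  _∪_ : Pred X c → Pred X c → Pred X c
  (a ∪ b) x = a x ⊎ b x

  -- a →̲ b  (w.r.t. ⪯)  and  a ⇝̲ b  (w.r.t. ⊏): same shape, different relation
  arrowOp : Rel X c → Pred X c → Pred X c → Pred X c
  arrowOp R a b x = ∀ y → R x y → a y → b y

record GFrame (c p : Level) : Set (lsuc (c ⊔ p)) where
  field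
    Carrier   : Set c
    _≈_       : Rel Carrier c
    _⪯_       : Rel Carrier c
    _⊏_       : Rel Carrier c
    isPartialOrder : IsPartialOrder _≈_ _⪯_
    ⪯-⊏       : ∀ {x y z} → x ⪯ y → y ⊏ z → x ⊏ z
    P         : Pred (Pred Carrier c) p
    P-upset   : ∀ {a} → P a → IsUpset _⪯_ a
    P-full    : P full
    P-empty   : P empty
    P-∩       : ∀ {a b} → P a → P b → P (a ∩ b)
    P-∪       : ∀ {a b} → P a → P b → P (a ∪ b)
    P-→       : ∀ {a b} → P a → P b → P (arrowOp _⪯_ a b)
    P-⇝       : ∀ {a b} → P a → P b → P (arrowOp _⊏_ a b)

module _ {c p : Level} (G : GFrame c p) where
  open GFrame G

  -- compactness: A ⊆ P, and B ⊆ P stands for the family {X∖b : b ∈ B}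
  Compact : Set (lsuc c ⊔ lsuc p)
  Compact =
    (A B : Pred (Pred Carrier c) p) →
    (∀ {a} → A a → P a) → (∀ {b} → B b → P b) →
    ((as bs : List (Pred Carrier c)) → All A as → All B bs →
       Σ Carrier λ x → All (λ a → a x) as × All (λ b → ¬ b x) bs) →
    Σ Carrier λ x → (∀ a → A a → a x) × (∀ b → B b → ¬ b x)

  ⪯-Refined : Set (c ⊔ lsuc c ⊔ p)
  ⪯-Refined = ∀ x y → ¬ (x ⪯ y) →
    Σ (Pred Carrier c) λ a → P a × a x × ¬ a y

  ⊏-Refined : Set (lsuc c ⊔ p)
  ⊏-Refined = ∀ x y → ¬ (x ⊏ y) →
    Σ (Pred Carrier c) λ a → Σ (Pred Carrier c) λ b →
      P a × P b × arrowOp _⊏_ a b x × a y × ¬ b y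

record DFrame (c p : Level) : Set (lsuc (c ⊔ p)) where
  field
    frame      : GFrame c p
    compact    : Compact frame
    ⪯-refined  : ⪯-Refined frame
    ⊏-refined  : ⊏-Refined frame

module _ {c p : Level} (G : GFrame c p) where
  open GFrame G

  Valuation : Set (lsuc c ⊔ p)
  Valuation = ℕ → Σ (Pred Carrier c) P

  ⟦_⟧ : Formula → Valuation → Pred Carrier c
  ⟦ var n ⟧ V   = proj₁ (V n)
  ⟦ ⊤' ⟧ V      = full
  ⟦ ⊥' ⟧ V      = empty
  ⟦ φ ∧' ψ ⟧ V  = ⟦ φ ⟧ V ∩ ⟦ ψ ⟧ V
  ⟦ φ ∨' ψ ⟧ V  = ⟦ φ ⟧ V ∪ ⟦ ψ ⟧ V
  ⟦ φ ⇒ ψ ⟧ V   = arrowOp _⪯_ (⟦ φ ⟧ V) (⟦ ψ ⟧ V)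
  ⟦ φ ⇝ ψ ⟧ V   = arrowOp _⊏_ (⟦ φ ⟧ V) (⟦ ψ ⟧ V)

  _⊩_ : Formula → Set (lsuc c ⊔ p)
  _⊩_ φ = (V : Valuation) → (x : Carrier) → ⟦ φ ⟧ V x

_⊩D_ : ∀ {c p} → DFrame c p → Formula → Set (lsuc c ⊔ p)
D ⊩D φ = _⊩_ (DFrame.frame D) φ

-- Points are the prime theories of Λ (sets of formulas closed under
-- Λ-provable implication, containing ⊤, closed under ∧, prime, without ⊥), ordered by
-- inclusion, with x ⊏ y when φ ⇝ ψ ∈ x and φ ∈ y force ψ ∈ y; the admissible sets are the
-- sets {x ∣ φ ∈ x}. The engine is a Lindenbaum lemma, proved with excluded middle along an
-- enumeration of formulas: for any relation ≼ between formulas that contains intuitionistic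
-- implication and is transitive, ∧-introducing on the right and ∨-eliminating on the left,
-- every ≼-consistent pair (L, R) extends to a prime theory containing L and disjoint from R.
-- Instantiating ≼ with "φ ⇒ ψ ∈ x" and "φ ⇝ ψ ∈ x" gives the counterexamples behind the
-- truth lemma for ⇒ and ⇝; with Λ-provable implication it gives compactness and completeness.
-- Refinedness is witnessed by the admissible sets {x ∣ φ ∈ x} themselves. The singleton
-- class consisting of this frame then characterises Λ.

module Submission where

open import Defs
open import Axiom.ExcludedMiddle using (ExcludedMiddle)
open import Axiom.DoubleNegationElimination using (em⇒dne)
open import Level using (Level; Lift; lift; lower) renaming (_⊔_ to _⊔ℓ_; suc to lsuc; zero to lzero)
open import Data.Empty using (⊥-elim)
open import Data.Unit.Polymorphic using (⊤)
open import Data.List using (List; []; _∷_; _++_; foldr; concatMap; cartesianProductWith)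
open import Data.List.Membership.Propositional using (_∈_)
open import Data.List.Membership.Propositional.Properties
  using (∈-++⁺ˡ; ∈-++⁺ʳ; ∈-concatMap⁺; ∈-cartesianProductWith⁺)
open import Data.List.Relation.Unary.All as All using (All; []; _∷_)
open import Data.List.Relation.Unary.All.Properties using (++⁺; All¬⇒¬Any)
open import Data.List.Relation.Unary.Any as Any using (Any; here; there)
open import Data.Nat using (ℕ; zero; suc; _≤_; _≤′_; ≤′-refl; ≤′-step; _⊔_)
open import Data.Nat.Properties using (≤⇒≤′; m≤m⊔n; m≤n⊔m)
open import Data.Product as Product using (Σ; ∃-syntax; _×_; _,_; proj₁; proj₂; swap)
open import Data.Sum as Sum using (_⊎_; inj₁; inj₂)
open import Function using (id; _∘_; flip; _⇔_; mk⇔; Equivalence)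
open import Relation.Binary.PropositionalEquality as ≡ using (_≡_; refl; cong₂)
open import Relation.Nullary using (¬_; yes; no)
open import Relation.Nullary.Decidable using (True; toWitness; fromWitness)
open import Relation.Binary using (IsPartialOrder)
open import Relation.Unary using (Pred; _⊆_; ∁)

variable
  Γ : List Formula
  φ ψ χ : Formula
  ls rs : List Formula

infix  3 _⊢_
infixl 5 _·_

data _⊢_ (Γ : List Formula) : Formula → Set where
  hyp   : φ ∈ Γ → Γ ⊢ φ
  axiom : IPC φ → Γ ⊢ φ
  _·_   : Γ ⊢ φ ⇒ ψ → Γ ⊢ φ → Γ ⊢ ψ

IPC-refl : ∀ φ → IPC (φ ⇒ φ)
IPC-refl φ = mp (mp (S φ (φ ⇒ φ) φ) (K φ (φ ⇒ φ))) (K φ φ)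

deduction : φ ∷ Γ ⊢ ψ → Γ ⊢ φ ⇒ ψ
deduction {φ} (hyp (here refl)) = axiom (IPC-refl φ)
deduction {φ} (hyp (there p))   = axiom (K _ φ) · hyp p
deduction {φ} (axiom i)         = axiom (K _ φ) · axiom i
deduction {φ} (d · e)           = axiom (S φ _ _) · deduction d · deduction e

⊢⇒IPC : [] ⊢ φ → IPC φ
⊢⇒IPC (axiom i) = i
⊢⇒IPC (d · e)   = mp (⊢⇒IPC d) (⊢⇒IPC e)

weaken : [] ⊢ φ → Γ ⊢ φ
weaken = axiom ∘ ⊢⇒IPC

#0 : φ ∷ Γ ⊢ φ
#0 = hyp (here refl)

#1 : ψ ∷ φ ∷ Γ ⊢ φ
#1 = hyp (there (here refl))

#2 : χ ∷ ψ ∷ φ ∷ Γ ⊢ φ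
#2 = hyp (there (there (here refl)))

#3 : ∀ {θ} → θ ∷ χ ∷ ψ ∷ φ ∷ Γ ⊢ φ
#3 = hyp (there (there (there (here refl))))

∧-intro : Γ ⊢ φ → Γ ⊢ ψ → Γ ⊢ φ ∧' ψ
∧-intro d e = axiom (∧I _ _) · d · e

∧-elim₁ : Γ ⊢ φ ∧' ψ → Γ ⊢ φ
∧-elim₁ d = axiom (∧E₁ _ _) · d

∧-elim₂ : Γ ⊢ φ ∧' ψ → Γ ⊢ ψ
∧-elim₂ d = axiom (∧E₂ _ _) · d

∨-intro₁ : Γ ⊢ φ → Γ ⊢ φ ∨' ψ
∨-intro₁ d = axiom (∨I₁ _ _) · d

∨-intro₂ : Γ ⊢ ψ → Γ ⊢ φ ∨' ψ
∨-intro₂ d = axiom (∨I₂ _ _) · d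

∨-elim : Γ ⊢ φ ∨' ψ → φ ∷ Γ ⊢ χ → ψ ∷ Γ ⊢ χ → Γ ⊢ χ
∨-elim d e f = axiom (∨E _ _ _) · deduction e · deduction f · d

ex-falso : Γ ⊢ ⊥' → Γ ⊢ φ
ex-falso d = axiom (⊥E _) · d

⋀ ⋁ : List Formula → Formula
⋀ = foldr _∧'_ ⊤'
⋁ = foldr _∨'_ ⊥'

⋀-++ : ∀ xs ys → [] ⊢ ⋀ (xs ++ ys) ⇒ ⋀ xs ∧' ⋀ ys
⋀-++ []       ys = deduction (∧-intro (axiom ⊤I) #0)
⋀-++ (x ∷ xs) ys = deduction (∧-intro (∧-intro (∧-elim₁ #0) (∧-elim₁ split)) (∧-elim₂ split))
  where split = weaken (⋀-++ xs ys) · ∧-elim₂ #0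

⋁-++ : ∀ xs ys → [] ⊢ ⋁ xs ∨' ⋁ ys ⇒ ⋁ (xs ++ ys)
⋁-++ []       ys = deduction (∨-elim #0 (ex-falso #0) #0)
⋁-++ (x ∷ xs) ys = deduction (∨-elim #0 (∨-elim #0 (∨-intro₁ #0) (∨-intro₂ (join (∨-intro₁ #0))))
                                         (∨-intro₂ (join (∨-intro₂ #0))))
  where join : ∀ {Γ} → Γ ⊢ ⋁ xs ∨' ⋁ ys → Γ ⊢ ⋁ (xs ++ ys)
        join d = weaken (⋁-++ xs ys) · d

module _ {a ℓ : Level} {A : Set a} (P : ℕ → Pred A ℓ) (P-step : ∀ n → P n ⊆ P (suc n)) where

  chain-mono : ∀ {m n} → m ≤ n → P m ⊆ P n
  chain-mono = mono′ ∘ ≤⇒≤′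
    where
    mono′ : ∀ {m n} → m ≤′ n → P m ⊆ P n
    mono′ ≤′-refl        = id
    mono′ (≤′-step m≤′n) = P-step _ ∘ mono′ m≤′n

  chain-all : ∀ {xs} → All (λ x → ∃[ n ] P n x) xs → ∃[ n ] All (P n) xs
  chain-all []               = 0 , []
  chain-all ((m , p) ∷ ps) with chain-all ps
  ... | n , qs = m ⊔ n , chain-mono (m≤m⊔n m n) p ∷ All.map (chain-mono (m≤n⊔m m n)) qs

binaryConnectives : List (Formula → Formula → Formula)
binaryConnectives = _∧'_ ∷ _∨'_ ∷ _⇒_ ∷ _⇝_ ∷ []

compoundsWith : List Formula → (Formula → Formula → Formula) → List Formula
compoundsWith xs _∘_ = cartesianProductWith _∘_ xs xs

binaryCompounds : List Formula → List Formula
binaryCompounds xs = concatMap (compoundsWith xs) binaryConnectives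

formulasOfRank : ℕ → List Formula
formulasOfRank zero    = ⊤' ∷ ⊥' ∷ []
formulasOfRank (suc n) = var n ∷ formulasOfRank n ++ binaryCompounds (formulasOfRank n)

formulasOfRank-step : ∀ n → (_∈ formulasOfRank n) ⊆ (_∈ formulasOfRank (suc n))
formulasOfRank-step n = there ∘ ∈-++⁺ˡ

compound-ranked : ∀ {_∘_} → _∘_ ∈ binaryConnectives →
  ∃[ n ] φ ∈ formulasOfRank n → ∃[ n ] ψ ∈ formulasOfRank n → ∃[ n ] (φ ∘ ψ) ∈ formulasOfRank n
compound-ranked {φ} {ψ} {_∘_} ∘∈ φ∈ ψ∈
  with chain-all (λ n → _∈ formulasOfRank n) formulasOfRank-step (φ∈ ∷ ψ∈ ∷ [])
... | n , φ∈ₙ ∷ ψ∈ₙ ∷ [] =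
  suc n , there (∈-++⁺ʳ (formulasOfRank n) (∈-concatMap⁺ (compoundsWith (formulasOfRank n))
                   (Any.map (λ { refl → ∈-cartesianProductWith⁺ _∘_ φ∈ₙ ψ∈ₙ }) ∘∈)))

formulasOfRank-complete : ∀ φ → ∃[ n ] φ ∈ formulasOfRank n
formulasOfRank-complete (var n)  = suc n , here refl
formulasOfRank-complete ⊤'       = 0 , here refl
formulasOfRank-complete ⊥'       = 0 , there (here refl)
formulasOfRank-complete (φ ∧' ψ) =
  compound-ranked (here refl) (formulasOfRank-complete φ) (formulasOfRank-complete ψ)
formulasOfRank-complete (φ ∨' ψ) =
  compound-ranked (there (here refl)) (formulasOfRank-complete φ) (formulasOfRank-complete ψ)
formulasOfRank-complete (φ ⇒ ψ)  =
  compound-ranked (there (there (here refl))) (formulasOfRank-complete φ) (formulasOfRank-complete ψ)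
formulasOfRank-complete (φ ⇝ ψ)  =
  compound-ranked (there (there (there (here refl)))) (formulasOfRank-complete φ) (formulasOfRank-complete ψ)

record Entailment ℓ : Set (lsuc ℓ) where
  infix 4 _≼_
  field
    _≼_     : Formula → Formula → Set ℓ
    ≼-IPC   : IPC (φ ⇒ ψ) → φ ≼ ψ
    ≼-trans : φ ≼ ψ → ψ ≼ χ → φ ≼ χ
    ≼-∧     : φ ≼ ψ → φ ≼ χ → φ ≼ ψ ∧' χ
    ≼-∨     : φ ≼ χ → ψ ≼ χ → φ ∨' ψ ≼ χ

  ≼-⊢ : [] ⊢ φ ⇒ ψ → φ ≼ ψ
  ≼-⊢ = ≼-IPC ∘ ⊢⇒IPC

  ≼-refl : φ ≼ φ
  ≼-refl = ≼-IPC (IPC-refl _)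

  ≼-∧-elim₁ : φ ∧' ψ ≼ φ
  ≼-∧-elim₁ = ≼-IPC (∧E₁ _ _)

  ≼-∧-elim₂ : φ ∧' ψ ≼ ψ
  ≼-∧-elim₂ = ≼-IPC (∧E₂ _ _)

  ≼-∨-intro₁ : φ ≼ φ ∨' ψ
  ≼-∨-intro₁ = ≼-IPC (∨I₁ _ _)

  ≼-∨-intro₂ : ψ ≼ φ ∨' ψ
  ≼-∨-intro₂ = ≼-IPC (∨I₂ _ _)

  ≼-singletons : φ ≼ ψ → ⋀ (φ ∷ []) ≼ ⋁ (ψ ∷ [])
  ≼-singletons φ≼ψ = ≼-trans ≼-∧-elim₁ (≼-trans φ≼ψ ≼-∨-intro₁)

record IsPrimeTheory {ℓR ℓ} (_≼_ : Formula → Formula → Set ℓR) (Δ : Pred Formula ℓ) : Set (ℓR ⊔ℓ ℓ) where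
  field
    closed   : φ ≼ ψ → Δ φ → Δ ψ
    has-⊤    : Δ ⊤'
    has-∧    : Δ φ → Δ ψ → Δ (φ ∧' ψ)
    prime    : Δ (φ ∨' ψ) → Δ φ ⊎ Δ ψ
    lacks-⊥  : ¬ Δ ⊥'

module Lindenbaum {ℓE : Level} (lem : ∀ {ℓ} → ExcludedMiddle ℓ) (E : Entailment ℓE) where
  open Entailment E
  open import Relation.Binary.Reasoning.Base.Single _≼_ ≼-refl ≼-trans

  Consistent : ∀ {ℓ} → Pred Formula ℓ → Pred Formula ℓ → Set (ℓ ⊔ℓ ℓE)
  Consistent L R = ∀ {ls rs} → All L ls → All R rs → ¬ (⋀ ls ≼ ⋁ rs)

  Consistent-anti : ∀ {ℓ} {L L′ R R′ : Pred Formula ℓ} →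
    L′ ⊆ L → R′ ⊆ R → Consistent L R → Consistent L′ R′
  Consistent-anti L′⊆L R′⊆R c ls∈ rs∈ = c (All.map L′⊆L ls∈) (All.map R′⊆R rs∈)

  singleton-consistent : ¬ (φ ≼ ψ) → Consistent (_≡ φ) (_≡ ψ)
  singleton-consistent {φ} {ψ} φ⋠ψ {ls} {rs} ls∈ rs∈ l≼r =
    φ⋠ψ (≼-trans (≼-⊢ (⋀-singleton ls∈)) (≼-trans l≼r (≼-⊢ (⋁-singleton rs∈))))
    where
    ⋀-singleton : ∀ {ls} → All (_≡ φ) ls → [] ⊢ φ ⇒ ⋀ ls
    ⋀-singleton []          = deduction (axiom ⊤I)
    ⋀-singleton (refl ∷ ps) = deduction (∧-intro #0 (weaken (⋀-singleton ps) · #0))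
    ⋁-singleton : ∀ {rs} → All (_≡ ψ) rs → [] ⊢ ⋁ rs ⇒ ψ
    ⋁-singleton []          = deduction (ex-falso #0)
    ⋁-singleton (refl ∷ ps) = deduction (∨-elim #0 #0 (weaken (⋁-singleton ps) · #0))

  infixl 6 _⊕_
  _⊕_ : ∀ {ℓ} → Pred Formula ℓ → Formula → Pred Formula ℓ
  (L ⊕ ψ) φ = L φ ⊎ φ ≡ ψ

  ⋀-⊕ : ∀ {ℓ} {L : Pred Formula ℓ} → All (L ⊕ ψ) ls →
    ∃[ ls′ ] All L ls′ × [] ⊢ ⋀ ls′ ∧' ψ ⇒ ⋀ ls
  ⋀-⊕ []                  = [] , [] , deduction (axiom ⊤I)
  ⋀-⊕ (inj₁ l∈ ∷ ls∈) with ⋀-⊕ ls∈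
  ... | ls′ , ls′∈ , d = _ ∷ ls′ , l∈ ∷ ls′∈ ,
    deduction (∧-intro (∧-elim₁ (∧-elim₁ #0)) (weaken d · ∧-intro (∧-elim₂ (∧-elim₁ #0)) (∧-elim₂ #0)))
  ⋀-⊕ (inj₂ refl ∷ ls∈) with ⋀-⊕ ls∈
  ... | ls′ , ls′∈ , d = ls′ , ls′∈ , deduction (∧-intro (∧-elim₂ #0) (weaken d · #0))

  ⋁-⊕ : ∀ {ℓ} {R : Pred Formula ℓ} → All (R ⊕ ψ) rs →
    ∃[ rs′ ] All R rs′ × [] ⊢ ⋁ rs ⇒ ψ ∨' ⋁ rs′
  ⋁-⊕ []                  = [] , [] , deduction (ex-falso #0)
  ⋁-⊕ (inj₁ r∈ ∷ rs∈) with ⋁-⊕ rs∈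
  ... | rs′ , rs′∈ , d = _ ∷ rs′ , r∈ ∷ rs′∈ ,
    deduction (∨-elim #0 (∨-intro₂ (∨-intro₁ #0)) (∨-elim (weaken d · #0) (∨-intro₁ #0) (∨-intro₂ (∨-intro₂ #0))))
  ⋁-⊕ (inj₂ refl ∷ rs∈) with ⋁-⊕ rs∈
  ... | rs′ , rs′∈ , d = rs′ , rs′∈ , deduction (∨-elim #0 (∨-intro₁ #0) (weaken d · #0))

  cut : ∀ {ls rs ls′ rs′} → ⋀ ls ≼ ψ ∨' ⋁ rs → ⋀ ls′ ∧' ψ ≼ ⋁ rs′ → ⋀ (ls ++ ls′) ≼ ⋁ (rs′ ++ rs)
  cut {ψ} {ls} {rs} {ls′} {rs′} l≼ψr lψ≼r′ = begin
    ⋀ (ls ++ ls′)          ∼⟨ ≼-∧ (≼-trans (≼-trans split ≼-∧-elim₁) l≼ψr) (≼-trans split ≼-∧-elim₂) ⟩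
    (ψ ∨' ⋁ rs) ∧' ⋀ ls′   ∼⟨ distribute ⟩
    (⋀ ls′ ∧' ψ) ∨' ⋁ rs   ∼⟨ ≼-∨ (≼-trans lψ≼r′ ≼-∨-intro₁) ≼-∨-intro₂ ⟩
    ⋁ rs′ ∨' ⋁ rs          ∼⟨ ≼-⊢ (⋁-++ rs′ rs) ⟩
    ⋁ (rs′ ++ rs)          ∎
    where
    split : ⋀ (ls ++ ls′) ≼ ⋀ ls ∧' ⋀ ls′
    split = ≼-⊢ (⋀-++ ls ls′)
    distribute : (ψ ∨' ⋁ rs) ∧' ⋀ ls′ ≼ (⋀ ls′ ∧' ψ) ∨' ⋁ rs
    distribute = ≼-⊢ (deduction (∨-elim (∧-elim₁ #0) (∨-intro₁ (∧-intro (∧-elim₂ #1) #0)) (∨-intro₂ #0)))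

  -- If both extensions were inconsistent, cutting the two refutations on ψ would refute (L, R).
  consistent-⊕ : ∀ {ℓ} {L R : Pred Formula ℓ} → Consistent L R → ∀ ψ →
    Consistent (L ⊕ ψ) R ⊎ Consistent L (R ⊕ ψ)
  consistent-⊕ {L = L} {R} c ψ with lem {P = Consistent (L ⊕ ψ) R}
  ... | yes c⊕ = inj₁ c⊕
  ... | no ¬c⊕ = inj₂ λ {ls} ls∈ rs∈ l≼r → ¬c⊕ λ {_} {rs′} ls′∈ rs′∈ l′≼r′ →
    let rs″ , rs″∈ , d = ⋁-⊕ rs∈
        ls″ , ls″∈ , e = ⋀-⊕ ls′∈
    in c (++⁺ ls∈ ls″∈) (++⁺ rs′∈ rs″∈)
         (cut {ls = ls} {rs″} {ls″} {rs′} (≼-trans l≼r (≼-⊢ d)) (≼-trans (≼-⊢ e) l′≼r′))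

  record ConsistentPair ℓ : Set (lsuc ℓ ⊔ℓ ℓE) where
    field
      left right : Pred Formula ℓ
      consistent : Consistent left right
  open ConsistentPair

  module _ {ℓ : Level} where

    infix 4 _⊑_
    _⊑_ : ConsistentPair ℓ → ConsistentPair ℓ → Set ℓ
    p ⊑ q = left p ⊆ left q × right p ⊆ right q

    Decides : ConsistentPair ℓ → Formula → Set ℓ
    Decides p ψ = left p ψ ⊎ right p ψ

    decideBy : (p : ConsistentPair ℓ) (ψ : Formula) →
      Consistent (left p ⊕ ψ) (right p) ⊎ Consistent (left p) (right p ⊕ ψ) → ConsistentPair ℓ
    decideBy p ψ (inj₁ c) = record { left = left p ⊕ ψ ; right = right p ; consistent = c }
    decideBy p ψ (inj₂ c) = record { left = left p ; right = right p ⊕ ψ ; consistent = c }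

    decideBy-⊒ : ∀ p ψ c → p ⊑ decideBy p ψ c
    decideBy-⊒ p ψ (inj₁ _) = inj₁ , id
    decideBy-⊒ p ψ (inj₂ _) = id , inj₁

    decideBy-decides : ∀ p ψ c → Decides (decideBy p ψ c) ψ
    decideBy-decides p ψ (inj₁ _) = inj₁ (inj₂ refl)
    decideBy-decides p ψ (inj₂ _) = inj₂ (inj₂ refl)

    decide : ConsistentPair ℓ → Formula → ConsistentPair ℓ
    decide p ψ = decideBy p ψ (consistent-⊕ (consistent p) ψ)

    decide-⊒ : ∀ p ψ → p ⊑ decide p ψ
    decide-⊒ p ψ = decideBy-⊒ p ψ (consistent-⊕ (consistent p) ψ)

    decide-decides : ∀ p ψ → Decides (decide p ψ) ψ
    decide-decides p ψ = decideBy-decides p ψ (consistent-⊕ (consistent p) ψ)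

    decideAll : List Formula → ConsistentPair ℓ → ConsistentPair ℓ
    decideAll []       p = p
    decideAll (ψ ∷ ψs) p = decide (decideAll ψs p) ψ

    decideAll-⊒ : ∀ ψs p → p ⊑ decideAll ψs p
    decideAll-⊒ []       p = id , id
    decideAll-⊒ (ψ ∷ ψs) p =
      let l₁ , r₁ = decideAll-⊒ ψs p
          l₂ , r₂ = decide-⊒ (decideAll ψs p) ψ
      in l₂ ∘ l₁ , r₂ ∘ r₁

    decideAll-decides : ∀ {ψs} p → ψ ∈ ψs → Decides (decideAll ψs p) ψ
    decideAll-decides {ψs = ψ ∷ ψs} p (here refl) = decide-decides (decideAll ψs p) ψ
    decideAll-decides {ψs = ψ ∷ ψs} p (there ψ∈) =
      Sum.map (proj₁ ⊒) (proj₂ ⊒) (decideAll-decides p ψ∈)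
      where ⊒ = decide-⊒ (decideAll ψs p) ψ

    -- Stage n + 1 decides every formula of rank n, so each formula is decided at a finite stage.
    stage : ConsistentPair ℓ → ℕ → ConsistentPair ℓ
    stage p zero    = p
    stage p (suc n) = decideAll (formulasOfRank n) (stage p n)

  module Limit {ℓ : Level} (p : ConsistentPair ℓ) where

    Left∞ Right∞ : Pred Formula ℓ
    Left∞  φ = ∃[ n ] left  (stage p n) φ
    Right∞ φ = ∃[ n ] right (stage p n) φ

    left-step : ∀ n → left (stage p n) ⊆ left (stage p (suc n))
    left-step n = proj₁ (decideAll-⊒ (formulasOfRank n) (stage p n))

    right-step : ∀ n → right (stage p n) ⊆ right (stage p (suc n))
    right-step n = proj₂ (decideAll-⊒ (formulasOfRank n) (stage p n))

    Left∞-consistent : Consistent Left∞ Right∞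
    Left∞-consistent ls∈ rs∈
      with chain-all (left ∘ stage p) left-step ls∈ | chain-all (right ∘ stage p) right-step rs∈
    ... | m , ls∈ₘ | n , rs∈ₙ =
      consistent (stage p (m ⊔ n))
        (All.map (chain-mono (left ∘ stage p) left-step (m≤m⊔n m n)) ls∈ₘ)
        (All.map (chain-mono (right ∘ stage p) right-step (m≤n⊔m m n)) rs∈ₙ)

    Left∞-decides : ∀ φ → Left∞ φ ⊎ Right∞ φ
    Left∞-decides φ with formulasOfRank-complete φ
    ... | n , φ∈ = Sum.map (suc n ,_) (suc n ,_) (decideAll-decides (stage p n) φ∈)

    Left∞-maximal : Consistent Left∞ (∁ Left∞)
    Left∞-maximal = Consistent-anti id ∉Left∞⇒Right∞ Left∞-consistent
      where
      ∉Left∞⇒Right∞ : ∁ Left∞ ⊆ Right∞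
      ∉Left∞⇒Right∞ {φ} φ∉ with Left∞-decides φ
      ... | inj₁ φ∈ = ⊥-elim (φ∉ φ∈)
      ... | inj₂ φ∈ = φ∈

  maximal⇒prime : ∀ {ℓ} {Δ : Pred Formula ℓ} → Consistent Δ (∁ Δ) → IsPrimeTheory _≼_ Δ
  maximal⇒prime c = record
    { closed  = λ φ≼ψ φ∈ → em⇒dne lem λ ψ∉ →
        c (φ∈ ∷ []) (ψ∉ ∷ []) (≼-singletons φ≼ψ)
    ; has-⊤   = em⇒dne lem λ ⊤∉ → c [] (⊤∉ ∷ []) ≼-∨-intro₁
    ; has-∧   = λ φ∈ ψ∈ → em⇒dne lem λ φψ∉ →
        c (φ∈ ∷ ψ∈ ∷ []) (φψ∉ ∷ [])
          (≼-⊢ (deduction (∨-intro₁ (∧-intro (∧-elim₁ #0) (∧-elim₁ (∧-elim₂ #0))))))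
    ; prime   = λ φψ∈ → em⇒dne lem λ ∉both →
        c (φψ∈ ∷ []) ((∉both ∘ inj₁) ∷ (∉both ∘ inj₂) ∷ [])
          (≼-⊢ (deduction (∨-elim (∧-elim₁ #0) (∨-intro₁ #0) (∨-intro₂ (∨-intro₁ #0)))))
    ; lacks-⊥ = λ ⊥∈ → c (⊥∈ ∷ []) [] ≼-∧-elim₁
    }

  lindenbaum : ∀ {ℓ} {L R : Pred Formula ℓ} → Consistent L R →
    Σ (Pred Formula ℓ) λ Δ → IsPrimeTheory _≼_ Δ × L ⊆ Δ × R ⊆ ∁ Δ
  lindenbaum {ℓ} {L} {R} c = Left∞ , maximal⇒prime Left∞-maximal , (0 ,_) , R⊆∁Left∞
    where
    initial : ConsistentPair ℓ
    initial = record { left = L ; right = R ; consistent = c }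
    open Limit initial
    R⊆∁Left∞ : R ⊆ ∁ Left∞
    R⊆∁Left∞ {φ} φ∈R φ∈Left∞ =
      Left∞-consistent (φ∈Left∞ ∷ []) ((0 , φ∈R) ∷ []) (≼-singletons ≼-refl)

sub-var : ∀ φ → sub var φ ≡ φ
sub-var (var n)  = refl
sub-var ⊤'       = refl
sub-var ⊥'       = refl
sub-var (φ ∧' ψ) = cong₂ _∧'_ (sub-var φ) (sub-var ψ)
sub-var (φ ∨' ψ) = cong₂ _∨'_ (sub-var φ) (sub-var ψ)
sub-var (φ ⇒ ψ)  = cong₂ _⇒_ (sub-var φ) (sub-var ψ)
sub-var (φ ⇝ ψ)  = cong₂ _⇝_ (sub-var φ) (sub-var ψ)

module CanonicalFrame (lem : ∀ {ℓ} → ExcludedMiddle ℓ) (Λ : Formula → Set) (isL : IsIALogic Λ) where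
  open IsIALogic isL

  infix 4 _⊢Λ_
  _⊢Λ_ : Formula → Formula → Set
  φ ⊢Λ ψ = Λ (φ ⇒ ψ)

  record Point : Set₁ where
    field
      theory  : Pred Formula lzero
      isPrime : IsPrimeTheory _⊢Λ_ theory

  infix 3 _∋_
  _∋_ : Point → Formula → Set
  x ∋ φ = Point.theory x φ

  module _ (x : Point) where
    open IsPrimeTheory (Point.isPrime x) public
      using () renaming (closed to ∋-closed; has-⊤ to ∋-⊤; has-∧ to ∋-∧; prime to ∋-∨; lacks-⊥ to ∌-⊥)

    ∋-IPC : IPC (φ ⇒ ψ) → x ∋ φ → x ∋ ψ
    ∋-IPC = ∋-closed ∘ ipc

    ∋-Λ : Λ φ → x ∋ φ
    ∋-Λ {φ} φ∈Λ = ∋-closed (closed-mp (ipc (K φ ⊤')) φ∈Λ) ∋-⊤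

    ∋-mp : x ∋ φ ⇒ ψ → x ∋ φ → x ∋ ψ
    ∋-mp φψ∈ φ∈ = ∋-IPC (⊢⇒IPC (deduction (∧-elim₁ #0 · ∧-elim₂ #0))) (∋-∧ φψ∈ φ∈)

    ∋-⋀ : All (x ∋_) ls → x ∋ ⋀ ls
    ∋-⋀ []         = ∋-⊤
    ∋-⋀ (φ∈ ∷ ls∈) = ∋-∧ φ∈ (∋-⋀ ls∈)

    ∋-⋁ : x ∋ ⋁ rs → Any (x ∋_) rs
    ∋-⋁ {[]}     ⊥∈  = ⊥-elim (∌-⊥ ⊥∈)
    ∋-⋁ {_ ∷ rs} φψ∈ with ∋-∨ φψ∈
    ... | inj₁ φ∈  = here φ∈
    ... | inj₂ rs∈ = there (∋-⋁ rs∈)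

  module _ {ℓ : Level} (Θ : Pred Formula ℓ) (Λ⊆Θ : Λ ⊆ Θ) (Θ-mp : ∀ {φ ψ} → Θ (φ ⇒ ψ) → Θ φ → Θ ψ) where

    Θ-⊢₂ : [] ⊢ φ ⇒ ψ ⇒ χ → Θ φ → Θ ψ → Θ χ
    Θ-⊢₂ d φ∈ ψ∈ = Θ-mp (Θ-mp (Λ⊆Θ (ipc (⊢⇒IPC d))) φ∈) ψ∈

    Θ-∧ : Θ φ → Θ ψ → Θ (φ ∧' ψ)
    Θ-∧ = Θ-⊢₂ (axiom (∧I _ _))

    ⇒-entailment : Entailment ℓ
    ⇒-entailment = record
      { _≼_     = λ φ ψ → Θ (φ ⇒ ψ)
      ; ≼-IPC   = Λ⊆Θ ∘ ipc
      ; ≼-trans = Θ-⊢₂ (deduction (deduction (deduction (#1 · (#2 · #0)))))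
      ; ≼-∧     = Θ-⊢₂ (deduction (deduction (deduction (∧-intro (#2 · #0) (#1 · #0)))))
      ; ≼-∨     = Θ-⊢₂ (deduction (deduction (deduction (∨-elim #0 (#3 · #0) (#2 · #0)))))
      }

    ⇝-entailment : Entailment ℓ
    ⇝-entailment = record
      { _≼_     = λ φ ψ → Θ (φ ⇝ ψ)
      ; ≼-IPC   = Λ⊆Θ ∘ ⇝-rule ∘ ipc
      ; ≼-trans = λ p q → Θ-mp (Λ⊆Θ (ax-tr _ _ _)) (Θ-∧ p q)
      ; ≼-∧     = λ p q → Θ-mp (Λ⊆Θ (ax-∧ _ _ _)) (Θ-∧ p q)
      ; ≼-∨     = λ p q → Θ-mp (Λ⊆Θ (ax-∨ _ _ _)) (Θ-∧ p q)
      }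

  ⊢Λ-entailment : Entailment lzero
  ⊢Λ-entailment = ⇒-entailment Λ id closed-mp

  module _ {ℓE : Level} (E : Entailment ℓE) (⊢Λ⊆≼ : ∀ {φ ψ} → φ ⊢Λ ψ → Entailment._≼_ E φ ψ) where
    open Entailment E
    open Lindenbaum lem E

    -- The Lindenbaum theory may live in a large universe; excluded middle squashes it into Set.
    prime-theory⇒point : ∀ {ℓ} {Δ : Pred Formula ℓ} → IsPrimeTheory _≼_ Δ →
      Σ Point λ y → Δ ⊆ (y ∋_) × (y ∋_) ⊆ Δ
    prime-theory⇒point {Δ = Δ} Δ-prime = y , squash , toWitness
      where
      open IsPrimeTheory Δ-prime
      squash : Δ φ → True (lem {P = Δ φ})
      squash = fromWitness
      y : Point
      y = record
        { theory  = λ φ → True (lem {P = Δ φ})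
        ; isPrime = record
          { closed  = λ φ⊢ψ → squash ∘ closed (⊢Λ⊆≼ φ⊢ψ) ∘ toWitness
          ; has-⊤   = squash has-⊤
          ; has-∧   = λ φ∈ ψ∈ → squash (has-∧ (toWitness φ∈) (toWitness ψ∈))
          ; prime   = Sum.map squash squash ∘ prime ∘ toWitness
          ; lacks-⊥ = lacks-⊥ ∘ toWitness
          }
        }

    extend-to-point : ∀ {ℓ} {L R : Pred Formula ℓ} → Consistent L R →
      Σ Point λ y → L ⊆ (y ∋_) × R ⊆ ∁ (y ∋_) × (∀ {φ ψ} → φ ≼ ψ → y ∋ φ → y ∋ ψ)
    extend-to-point c =
      let Δ , Δ-prime , L⊆Δ , R⊆∁Δ = lindenbaum c
          y , Δ⊆y , y⊆Δ = prime-theory⇒point Δ-prime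
      in y , Δ⊆y ∘ L⊆Δ , (λ φ∈R → R⊆∁Δ φ∈R ∘ y⊆Δ) ,
         λ φ≼ψ → Δ⊆y ∘ IsPrimeTheory.closed Δ-prime φ≼ψ ∘ y⊆Δ

  -- Records rather than bare functions, so that the relations live in Set₁ as GFrame demands.
  infix 4 _⊆ₚ_ _⊏ₚ_

  record _⊆ₚ_ (x y : Point) : Set₁ where
    constructor incl
    field included : x ∋ φ → y ∋ φ
  open _⊆ₚ_

  record _⊏ₚ_ (x y : Point) : Set₁ where
    constructor access
    field ⇝-elim : x ∋ φ ⇝ ψ → y ∋ φ → y ∋ ψ
  open _⊏ₚ_

  ⊆ₚ-trans : ∀ {x y z} → x ⊆ₚ y → y ⊆ₚ z → x ⊆ₚ z
  ⊆ₚ-trans x⊆y y⊆z = incl (included y⊆z ∘ included x⊆y)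

  ⊆ₚ-isPartialOrder : IsPartialOrder (λ x y → x ⊆ₚ y × y ⊆ₚ x) _⊆ₚ_
  ⊆ₚ-isPartialOrder = record
    { isPreorder = record
      { isEquivalence = record
        { refl  = incl id , incl id
        ; sym   = swap
        ; trans = Product.zip ⊆ₚ-trans (flip ⊆ₚ-trans)
        }
      ; reflexive = proj₁
      ; trans     = ⊆ₚ-trans
      }
    ; antisym = _,_
    }

  ⇒-counterexample : ∀ x → ¬ (x ∋ φ ⇒ ψ) → Σ Point λ y → x ⊆ₚ y × y ∋ φ × ¬ (y ∋ ψ)
  ⇒-counterexample x φψ∉ =
    let y , φ∈ , ψ∉ , y-closed = extend-to-point E (∋-Λ x) (singleton-consistent φψ∉)
    in y , incl (λ χ∈ → y-closed (∋-IPC x (K _ ⊤') χ∈) (∋-⊤ y)) , φ∈ refl , ψ∉ refl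
    where
    E : Entailment lzero
    E = ⇒-entailment (x ∋_) (∋-Λ x) (∋-mp x)
    open Lindenbaum lem E using (singleton-consistent)

  ⇝-counterexample : ∀ x → ¬ (x ∋ φ ⇝ ψ) → Σ Point λ y → x ⊏ₚ y × y ∋ φ × ¬ (y ∋ ψ)
  ⇝-counterexample x φψ∉ =
    let y , φ∈ , ψ∉ , y-closed = extend-to-point E (∋-Λ x ∘ ⇝-rule) (singleton-consistent φψ∉)
    in y , access y-closed , φ∈ refl , ψ∉ refl
    where
    E : Entailment lzero
    E = ⇝-entailment (x ∋_) (∋-Λ x) (∋-mp x)
    open Lindenbaum lem E using (singleton-consistent)

  infix 3 _defines_
  _defines_ : Formula → Pred Point (lsuc lzero) → Set₁
  χ defines a = ∀ x → a x ⇔ (x ∋ χ)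

  Definable : Pred (Pred Point (lsuc lzero)) (lsuc lzero)
  Definable a = Σ Formula (_defines a)

  pointsOf : Formula → Pred Point (lsuc lzero)
  pointsOf φ x = Lift (lsuc lzero) (x ∋ φ)

  pointsOf-defined : ∀ φ → φ defines pointsOf φ
  pointsOf-defined φ x = mk⇔ lower lift

  module _ {a b : Pred Point (lsuc lzero)} (φ-a : φ defines a) (ψ-b : ψ defines b) where
    private
      in-a : ∀ {x} → a x → x ∋ φ
      in-a = Equivalence.to (φ-a _)
      into-a : ∀ {x} → x ∋ φ → a x
      into-a = Equivalence.from (φ-a _)
      in-b : ∀ {x} → b x → x ∋ ψ
      in-b = Equivalence.to (ψ-b _)
      into-b : ∀ {x} → x ∋ ψ → b x
      into-b = Equivalence.from (ψ-b _)

    ∧-defines : φ ∧' ψ defines a ∩ b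
    ∧-defines x = mk⇔
      (λ (u , v) → ∋-∧ x (in-a u) (in-b v))
      (λ φψ∈ → into-a (∋-IPC x (∧E₁ φ ψ) φψ∈) , into-b (∋-IPC x (∧E₂ φ ψ) φψ∈))

    ∨-defines : φ ∨' ψ defines a ∪ b
    ∨-defines x = mk⇔
      Sum.[ ∋-IPC x (∨I₁ φ ψ) ∘ in-a , ∋-IPC x (∨I₂ φ ψ) ∘ in-b ]
      (Sum.map into-a into-b ∘ ∋-∨ x)

    arrowOp-defines : ∀ {_⊙_ : Formula → Formula → Formula} {R : Point → Point → Set₁} →
      (∀ x → ¬ (x ∋ φ ⊙ ψ) → Σ Point λ y → R x y × y ∋ φ × ¬ (y ∋ ψ)) →
      (∀ {x y} → R x y → x ∋ φ ⊙ ψ → y ∋ φ → y ∋ ψ) →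
      φ ⊙ ψ defines arrowOp R a b
    arrowOp-defines {_⊙_} {R} counterexample R-elim x = mk⇔ to-⊙ from-⊙
      where
      to-⊙ : arrowOp R a b x → x ∋ φ ⊙ ψ
      to-⊙ a→b = em⇒dne lem λ φψ∉ → refute (counterexample x φψ∉)
        where
        refute : ¬ (Σ Point λ y → R x y × y ∋ φ × ¬ (y ∋ ψ))
        refute (y , xRy , φ∈ , ψ∉) = ψ∉ (in-b (a→b y xRy (into-a φ∈)))
      from-⊙ : x ∋ φ ⊙ ψ → arrowOp R a b x
      from-⊙ φψ∈ y xRy u = into-b (R-elim xRy φψ∈ (in-a u))

    ⇒-defines : φ ⇒ ψ defines arrowOp _⊆ₚ_ a b
    ⇒-defines = arrowOp-defines {_⊙_ = _⇒_} ⇒-counterexample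
                  λ {_} {y} x⊆y φψ∈ → ∋-mp y (included x⊆y φψ∈)

    ⇝-defines : φ ⇝ ψ defines arrowOp _⊏ₚ_ a b
    ⇝-defines = arrowOp-defines {_⊙_ = _⇝_} ⇝-counterexample λ x⊏y → ⇝-elim x⊏y

  ⊤-defines : ⊤' defines full
  ⊤-defines x = mk⇔ (λ _ → ∋-⊤ x) _

  ⊥-defines : ⊥' defines empty
  ⊥-defines x = mk⇔ (λ ()) (⊥-elim ∘ ∌-⊥ x)

  -- Points have no extensional equality, so ≈ is mutual inclusion.
  canonicalGFrame : GFrame (lsuc lzero) (lsuc lzero)
  canonicalGFrame = record
    { Carrier        = Point
    ; _≈_            = λ x y → x ⊆ₚ y × y ⊆ₚ x
    ; _⪯_            = _⊆ₚ_
    ; _⊏_            = _⊏ₚ_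
    ; isPartialOrder = ⊆ₚ-isPartialOrder
    ; ⪯-⊏            = λ x⊆y y⊏z → access (⇝-elim y⊏z ∘ included x⊆y)
    ; P              = Definable
    ; P-upset        = λ (_ , χ-a) x⊆y u →
                         Equivalence.from (χ-a _) (included x⊆y (Equivalence.to (χ-a _) u))
    ; P-full         = ⊤' , ⊤-defines
    ; P-empty        = ⊥' , ⊥-defines
    ; P-∩            = λ (_ , φ-a) (_ , ψ-b) → _ , ∧-defines φ-a ψ-b
    ; P-∪            = λ (_ , φ-a) (_ , ψ-b) → _ , ∨-defines φ-a ψ-b
    ; P-→            = λ (_ , φ-a) (_ , ψ-b) → _ , ⇒-defines φ-a ψ-b
    ; P-⇝            = λ (_ , φ-a) (_ , ψ-b) → _ , ⇝-defines φ-a ψ-b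
    }

  DefiningFormula : Pred (Pred Point (lsuc lzero)) (lsuc lzero) → Pred Formula (lsuc (lsuc lzero))
  DefiningFormula A χ = Σ (Pred Point (lsuc lzero)) λ a → A a × χ defines a

  defined-sets : ∀ {A χs} → All (DefiningFormula A) χs →
    Σ (List (Pred Point (lsuc lzero))) λ as → All A as ×
      (∀ x → (All (λ a → a x) as → All (x ∋_) χs) × (All (λ a → ¬ a x) as → All (λ χ → ¬ (x ∋ χ)) χs))
  defined-sets [] = [] , [] , λ _ → (λ _ → []) , (λ _ → [])
  defined-sets ((a , a∈A , χ-a) ∷ χs∈) with defined-sets χs∈
  ... | as , as∈A , as-χs = a ∷ as , a∈A ∷ as∈A , λ x →
    (λ { (u ∷ us) → Equivalence.to (χ-a x) u ∷ proj₁ (as-χs x) us }) ,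
    (λ { (u ∷ us) → u ∘ Equivalence.from (χ-a x) ∷ proj₂ (as-χs x) us })

  -- By the finite intersection property, the formulas defining members of A and those defining
  -- members of B form a Λ-consistent pair; its prime extension lies in every a ∈ A and no b ∈ B.
  canonical-compact : Compact canonicalGFrame
  canonical-compact A B A-definable B-definable fip =
    let y , A⊆y , B⊆∁y , _ = extend-to-point ⊢Λ-entailment id consistent
    in y , (λ a a∈A → let χ , χ-a = A-definable a∈A in Equivalence.from (χ-a y) (A⊆y (a , a∈A , χ-a))) ,
           (λ b b∈B → let χ , χ-b = B-definable b∈B in B⊆∁y (b , b∈B , χ-b) ∘ Equivalence.to (χ-b y))
    where
    open Lindenbaum lem ⊢Λ-entailment using (Consistent)
    consistent : Consistent (DefiningFormula A) (DefiningFormula B)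
    consistent ls∈ rs∈ ⊢ls⇒rs with defined-sets ls∈ | defined-sets rs∈
    ... | as , as∈A , as-ls | bs , bs∈B , bs-rs with fip as bs as∈A bs∈B
    ... | x , x∈as , x∉bs =
      All¬⇒¬Any (proj₂ (bs-rs x) x∉bs) (∋-⋁ x (∋-mp x (∋-Λ x ⊢ls⇒rs) (∋-⋀ x (proj₁ (as-ls x) x∈as))))

  canonical-⪯-refined : ⪯-Refined canonicalGFrame
  canonical-⪯-refined x y x⊈y with lem {P = ∃[ φ ] x ∋ φ × ¬ (y ∋ φ)}
  ... | yes (φ , φ∈x , φ∉y) = pointsOf φ , (φ , pointsOf-defined φ) , lift φ∈x , φ∉y ∘ lower
  ... | no ∄φ = ⊥-elim (x⊈y (incl λ φ∈x → em⇒dne lem λ φ∉y → ∄φ (_ , φ∈x , φ∉y)))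

  canonical-⊏-refined : ⊏-Refined canonicalGFrame
  canonical-⊏-refined x y x⊏̸y with lem {P = ∃[ φ ] ∃[ ψ ] x ∋ φ ⇝ ψ × y ∋ φ × ¬ (y ∋ ψ)}
  ... | yes (φ , ψ , φψ∈x , φ∈y , ψ∉y) =
    pointsOf φ , pointsOf ψ , (φ , pointsOf-defined φ) , (ψ , pointsOf-defined ψ) ,
    (λ z x⊏z u → lift (⇝-elim x⊏z φψ∈x (lower u))) , lift φ∈y , ψ∉y ∘ lower
  ... | no ∄φψ = ⊥-elim (x⊏̸y (access λ φψ∈x φ∈y → em⇒dne lem λ ψ∉y → ∄φψ (_ , _ , φψ∈x , φ∈y , ψ∉y)))

  canonicalFrame : DFrame (lsuc lzero) (lsuc lzero)
  canonicalFrame = record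
    { frame     = canonicalGFrame
    ; compact   = canonical-compact
    ; ⪯-refined = canonical-⪯-refined
    ; ⊏-refined = canonical-⊏-refined
    }

  definingSubst : Valuation canonicalGFrame → Subst
  definingSubst V n = proj₁ (proj₂ (V n))

  truth-lemma : ∀ V φ → sub (definingSubst V) φ defines ⟦_⟧ canonicalGFrame φ V
  truth-lemma V (var n)  = proj₂ (proj₂ (V n))
  truth-lemma V ⊤'       = ⊤-defines
  truth-lemma V ⊥'       = ⊥-defines
  truth-lemma V (φ ∧' ψ) = ∧-defines (truth-lemma V φ) (truth-lemma V ψ)
  truth-lemma V (φ ∨' ψ) = ∨-defines (truth-lemma V φ) (truth-lemma V ψ)
  truth-lemma V (φ ⇒ ψ)  = ⇒-defines (truth-lemma V φ) (truth-lemma V ψ)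
  truth-lemma V (φ ⇝ ψ)  = ⇝-defines (truth-lemma V φ) (truth-lemma V ψ)

  canonical-sound : Λ φ → canonicalFrame ⊩D φ
  canonical-sound {φ} φ∈Λ V x =
    Equivalence.from (truth-lemma V φ x) (∋-Λ x (subst (definingSubst V) φ∈Λ))

  canonical-complete : canonicalFrame ⊩D φ → Λ φ
  canonical-complete {φ} ⊩φ = em⇒dne lem λ φ∉Λ →
    let open Lindenbaum lem ⊢Λ-entailment using (singleton-consistent)
        y , _ , φ∉y , _ = extend-to-point ⊢Λ-entailment id
                            (singleton-consistent λ ⊤⊢φ → φ∉Λ (closed-mp ⊤⊢φ (ipc ⊤I)))
    in φ∉y refl (≡.subst (y ∋_) (sub-var φ) (Equivalence.to (truth-lemma V₀ φ y) (⊩φ V₀ y)))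
    where
    V₀ : Valuation canonicalGFrame
    V₀ n = pointsOf (var n) , var n , pointsOf-defined (var n)

theorem3p23 : (∀ {ℓ} → ExcludedMiddle ℓ) →
    (Λ : Formula → Set) → IsIALogic Λ →
    Σ (Set (lsuc lzero)) λ I → Σ (I → DFrame (lsuc lzero) (lsuc lzero)) λ 𝒞 →
      ∀ φ → (Λ φ → ∀ i → 𝒞 i ⊩D φ) × ((∀ i → 𝒞 i ⊩D φ) → Λ φ)
theorem3p23 lem Λ isL =
  ⊤ , (λ _ → canonicalFrame) ,
  λ φ → (λ φ∈Λ _ → canonical-sound φ∈Λ) , (λ ⊩φ → canonical-complete (⊩φ _))
  where open CanonicalFrame lem Λ isL
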